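{- For every $n=1,2,\dots$ the following identities hold in the completion $\hat\Lambda$ of the ring of symmetric functions: $W_{1^n}=\sum_{k\ge0}\binom{n+k-1}{k}\mathbb{F}_{1^{n+k}}=\mathbb{F}_{1^n}+\binom{n}{1}\mathbb{F}_{1^{n+1}}+\binom{n+1}{2}\mathbb{F}_{1^{n+2}}+\binom{n+2}{3}\mathbb{F}_{1^{n+3}}+\cdots$, $\mathbb{F}_{1^n}=\sum_{k\ge0}(-1)^k\binom{n+k-1}{k}W_{1^{n+k}}=W_{1^n}-\binom{n}{1}W_{1^{n+1}}+\binom{n+1}{2}W_{1^{n+2}}-\binom{n+2}{3}W_{1^{n+3}}+\cdots$.
   Context: $1^n$ denotes the partition with $n$ parts equal to $1$. Partitions have finitely many nonzero parts; $\mu\prec\lambda$ means $\lambda_{i+1}\le\mu_i\le\lambda_i$ for all $i$; $(x;q)_k=\prod_{i=0}^{k-1}(1-xq^i)$. $q$-Whittaker functions: $W_{\lambda/\mu}(x)=\mathbf{1}_{\mu\prec\lambda}\,x^{|\lambda|-|\mu|}\prod_{r\ge1}\frac{(q;q)_{\lambda_r-\lambda_{r+1}}}{(q;q)_{\lambda_r-\mu_r}(q;q)_{\mu_r-\lambda_{r+1}}}$; inhomogeneous $q$-Whittaker functions: $\mathbb{F}_{\lambda/\mu}(x)=\mathbf{1}_{\mu\prec\lambda}\,x^{|\lambda|-|\mu|}\prod_{r=1}^{\ell(\lambda)}(x;q)_{\mu_r-\lambda_{r+1}}\frac{(q;q)_{\lambda_r-\lambda_{r+1}}}{(q;q)_{\lambda_r-\mu_r}(q;q)_{\mu_r-\lambda_{r+1}}}$.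 Both are extended to $n$ variables by the branching rule $G_{\lambda/\mu}(x_1,\dots,x_n)=\sum_\nu G_{\nu/\mu}(x_1,\dots,x_{n-1})G_{\lambda/\nu}(x_n)$ and to countably many variables by stability; $G_\lambda=G_{\lambda/\varnothing}$. The infinite sums converge in the degree topology of $\hat\Lambda$ (symmetric formal power series of unbounded degree). -}

module Defs where

open import Algebra.Bundles using (CommutativeRing)
open import Data.Nat as ℕ using (ℕ; zero; suc; _∸_)
open import Data.Nat.ListAction using (sum)
open import Data.Bool using (Bool; true; false; if_then_else_)
open import Data.List using (List; []; _∷_; [_]; map; concatMap; upTo; replicate)
open import Data.Fin using (Fin; inject₁; fromℕ)
open import Function using (_∘_)

-- Partitions are represented as lists of natural numbers λ₁ ≥ λ₂ ≥ ...;
-- trailing zeros are allowed (all parts beyond the list are 0).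

col : ℕ → List ℕ
col n = replicate n 1

isEmptyPart : List ℕ → Bool
isEmptyPart [] = true
isEmptyPart (zero ∷ l) = isEmptyPart l
isEmptyPart (suc _ ∷ l) = false

range : ℕ → ℕ → List ℕ
range lo hi = map (lo ℕ.+_) (upTo (suc (hi ∸ lo)))

-- all ν with ν ≺ λ (interlacing: λ_{i+1} ≤ ν_i ≤ λ_i), listed with the same
-- length as λ (so that λ_{ℓ+1} = 0 is used for the last part).
interl : List ℕ → List (List ℕ)
interl [] = [ [] ]
interl (a ∷ []) = map (λ c → c ∷ []) (range 0 a)
interl (a ∷ b ∷ l) = concatMap (λ c → map (c ∷_) (interl (b ∷ l))) (range b a)

module Sym {c ℓ} (R : CommutativeRing c ℓ) where
  open CommutativeRing R public

  pow : Carrier → ℕ → Carrier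
  pow x zero = 1#
  pow x (suc k) = pow x k * x

  ι : ℕ → Carrier
  ι zero = 0#
  ι (suc n) = 1# + ι n

  sumTo : ℕ → (ℕ → Carrier) → Carrier
  sumTo zero f = 0#
  sumTo (suc K) f = sumTo K f + f K

  sumL : List Carrier → Carrier
  sumL [] = 0#
  sumL (a ∷ as) = a + sumL as

  poch : Carrier → Carrier → ℕ → Carrier
  poch x q zero = 1#
  poch x q (suc k) = poch x q k * (1# - x * pow q k)

  -- q-binomial coefficient [n choose k]_q = (q;q)_n / ((q;q)_k (q;q)_{n-k}),
  -- computed by the q-Pascal rule (a polynomial in q, so no division needed)
  qbinom : Carrier → ℕ → ℕ → Carrier
  qbinom q n zero = 1#
  qbinom q zero (suc k) = 0#
  qbinom q (suc n) (suc k) = qbinom q n k + pow q (suc k) * qbinom q n (suc k)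

  -- ∏_r (q;q)_{λ_r-λ_{r+1}} / ((q;q)_{λ_r-μ_r} (q;q)_{μ_r-λ_{r+1}})
  --   = ∏_r [λ_r-λ_{r+1} choose λ_r-μ_r]_q          (for μ ≺ λ)
  wprod : Carrier → List ℕ → List ℕ → Carrier
  wprod q (a ∷ b ∷ l) (m ∷ μ) = qbinom q (a ∸ b) (a ∸ m) * wprod q (b ∷ l) μ
  wprod q (a ∷ []) (m ∷ μ) = qbinom q a (a ∸ m)
  wprod q _ _ = 1#

  -- ∏_r (x;q)_{μ_r-λ_{r+1}} (q;q)_{λ_r-λ_{r+1}} / ((q;q)_{λ_r-μ_r} (q;q)_{μ_r-λ_{r+1}})
  -- (factors with λ_r = 0 are equal to 1, so the range r ≤ ℓ(λ) is immaterial)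
  fprod : Carrier → Carrier → List ℕ → List ℕ → Carrier
  fprod q x (a ∷ b ∷ l) (m ∷ μ) =
    poch x q (m ∸ b) * qbinom q (a ∸ b) (a ∸ m) * fprod q x (b ∷ l) μ
  fprod q x (a ∷ []) (m ∷ μ) = poch x q m * qbinom q a (a ∸ m)
  fprod q x _ _ = 1#

  -- one-variable skew functions W_{λ/μ}(x), 𝔽_{λ/μ}(x), for μ ≺ λ
  -- (only ever applied to μ ∈ interl λ, so the indicator 1_{μ≺λ} is built in)
  Wskew : Carrier → Carrier → List ℕ → List ℕ → Carrier
  Wskew q x lam μ = pow x (sum lam ∸ sum μ) * wprod q lam μ

  Fskew : Carrier → Carrier → List ℕ → List ℕ → Carrier
  Fskew q x lam μ = pow x (sum lam ∸ sum μ) * fprod q x lam μ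

  branch : (Carrier → List ℕ → List ℕ → Carrier) →
           (n : ℕ) → (Fin n → Carrier) → List ℕ → Carrier
  branch f zero xs lam = if isEmptyPart lam then 1# else 0#
  branch f (suc n) xs lam =
    sumL (map (λ ν → branch f n (xs ∘ inject₁) ν * f (xs (fromℕ n)) lam ν) (interl lam))

  W : Carrier → (n : ℕ) → (Fin n → Carrier) → List ℕ → Carrier
  W q = branch (Wskew q)

  𝔽 : Carrier → (n : ℕ) → (Fin n → Carrier) → List ℕ → Carrier
  𝔽 q = branch (Fskew q)

{-# OPTIONS --safe #-}
-- On a column the branching rule has only two terms: adding a variable x, the
-- column 1^m either grows from 1^(m-1) (weight x) or stays 1^m (weight 1 for W,
-- 1 - x for 𝔽).  Hence W_{1^m} and 𝔽_{1^m} are the column functions of the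
-- weights 1 and 1 - x, and for stay-weights v, w with v(x) = d x + w(x) one has
--   G^v_n = Σ_k d^k C(n+k-1, k) G^w_{n+k}
-- by induction on the number of variables, the step being Pascal's rule.
-- With N variables every truncation at K > N is already exact.
module Submission where

open import Defs
open import Algebra.Bundles using (CommutativeRing)
open import Data.Nat as ℕ using (ℕ; zero; suc; s≤s; _≤_; _∸_)
open import Data.Nat.Combinatorics using (_C_; nCk+nC[k+1]≡[n+1]C[k+1]; k>n⇒nCk≡0)
open import Data.Fin using (Fin; inject₁; fromℕ)
open import Data.Product using (Σ-syntax; _×_; _,_)

open import Level using (_⊔_)
open import Data.Nat.Properties using (+-suc; n∸n≡0; m+n∸n≡m; m<n⇒m<1+n; n<1+n)
open import Data.Nat.ListAction using (sum)
open import Data.List using (List; []; _∷_; [_]; _++_; map; replicate)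
open import Data.List.Properties using (++-identityʳ)
open import Data.Bool using (true)
open import Function using (_∘_)
open import Relation.Binary.PropositionalEquality as ≡ using (_≡_)
import Algebra.Properties.CommutativeSemigroup as CommutativeSemigroupProperties
import Algebra.Properties.Ring as RingProperties
import Relation.Binary.Reasoning.Setoid as SetoidReasoning

zeros : ℕ → List ℕ
zeros b = replicate b 0

sum-col++zeros : ∀ m b → sum (col m ++ zeros b) ≡ m
sum-col++zeros zero zero = ≡.refl
sum-col++zeros zero (suc b) = sum-col++zeros zero b
sum-col++zeros (suc m) b = ≡.cong suc (sum-col++zeros m b)

isEmptyPart-zeros : ∀ b → isEmptyPart (zeros b) ≡ true
isEmptyPart-zeros zero = ≡.refl
isEmptyPart-zeros (suc b) = isEmptyPart-zeros b

interl-zeros : ∀ b → interl (zeros b) ≡ [ zeros b ]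
interl-zeros zero = ≡.refl
interl-zeros (suc zero) = ≡.refl
interl-zeros (suc (suc b)) rewrite interl-zeros (suc b) = ≡.refl

interl-col++zeros : ∀ m b →
  interl (col (suc m) ++ zeros b) ≡ (col m ++ zeros (suc b)) ∷ (col (suc m) ++ zeros b) ∷ []
interl-col++zeros zero zero = ≡.refl
interl-col++zeros zero (suc b) rewrite interl-zeros (suc b) = ≡.refl
interl-col++zeros (suc m) b rewrite interl-col++zeros m b = ≡.refl

module ColumnFunctions {r ℓ} (R : CommutativeRing r ℓ) where
  open Sym R hiding (zero)
  open SetoidReasoning setoid
  open CommutativeSemigroupProperties *-commutativeSemigroup using (x∙yz≈y∙xz)
  open CommutativeSemigroupProperties +-commutativeSemigroup using (interchange)
    renaming (x∙yz≈y∙xz to +-x∙yz≈y∙xz)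
  open RingProperties ring using (-1*x≈-x)

  ι-+ : ∀ m n → ι (m ℕ.+ n) ≈ ι m + ι n
  ι-+ zero n = sym (+-identityˡ (ι n))
  ι-+ (suc m) n = trans (+-congˡ (ι-+ m n)) (sym (+-assoc 1# (ι m) (ι n)))

  pow-1# : ∀ k → pow 1# k ≈ 1#
  pow-1# zero = refl
  pow-1# (suc k) = trans (*-identityʳ (pow 1# k)) (pow-1# k)

  1x+[1-x]≈1 : ∀ x → 1# * x + (1# - x) ≈ 1#
  1x+[1-x]≈1 x = begin
    1# * x + (1# - x) ≈⟨ +-congʳ (*-identityˡ x) ⟩
    x + (1# - x)      ≈⟨ +-x∙yz≈y∙xz x 1# (- x) ⟩
    1# + (x - x)      ≈⟨ +-congˡ (-‿inverseʳ x) ⟩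
    1# + 0#           ≈⟨ +-identityʳ 1# ⟩
    1#                ∎

  -1x+1≈1-x : ∀ x → - 1# * x + 1# ≈ 1# - x
  -1x+1≈1-x x = trans (+-congʳ (-1*x≈-x x)) (+-comm (- x) 1#)

  sumTo-cong : ∀ K {f g : ℕ → Carrier} → (∀ k → f k ≈ g k) → sumTo K f ≈ sumTo K g
  sumTo-cong zero f≈g = refl
  sumTo-cong (suc K) f≈g = +-cong (sumTo-cong K f≈g) (f≈g K)

  sumTo-zero : ∀ K {f : ℕ → Carrier} → (∀ k → f k ≈ 0#) → sumTo K f ≈ 0#
  sumTo-zero zero f≈0 = refl
  sumTo-zero (suc K) f≈0 = trans (+-cong (sumTo-zero K f≈0) (f≈0 K)) (+-identityʳ 0#)

  sumTo-+ : ∀ K (f g : ℕ → Carrier) → sumTo K (λ k → f k + g k) ≈ sumTo K f + sumTo K g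
  sumTo-+ zero f g = sym (+-identityʳ 0#)
  sumTo-+ (suc K) f g = trans (+-congʳ (sumTo-+ K f g)) (interchange _ _ _ _)

  sumTo-*ˡ : ∀ K a (f : ℕ → Carrier) → sumTo K (λ k → a * f k) ≈ a * sumTo K f
  sumTo-*ˡ zero a f = sym (zeroʳ a)
  sumTo-*ˡ (suc K) a f = trans (+-congʳ (sumTo-*ˡ K a f)) (sym (distribˡ a _ _))

  sumTo-*ʳ : ∀ K a (f : ℕ → Carrier) → sumTo K (λ k → f k * a) ≈ sumTo K f * a
  sumTo-*ʳ zero a f = sym (zeroˡ a)
  sumTo-*ʳ (suc K) a f = trans (+-congʳ (sumTo-*ʳ K a f)) (sym (distribʳ a _ _))

  sumTo-head : ∀ K (f : ℕ → Carrier) → sumTo (suc K) f ≈ f 0 + sumTo K (f ∘ suc)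
  sumTo-head zero f = trans (+-identityˡ (f 0)) (sym (+-identityʳ (f 0)))
  sumTo-head (suc K) f = trans (+-congʳ (sumTo-head K f)) (+-assoc _ _ _)

  column : (Carrier → Carrier) → (N : ℕ) → (Fin N → Carrier) → ℕ → Carrier
  column w N xs zero = 1#
  column w zero xs (suc m) = 0#
  column w (suc N) xs (suc m) =
    column w N (xs ∘ inject₁) m * xs (fromℕ N)
      + column w N (xs ∘ inject₁) (suc m) * w (xs (fromℕ N))

  coeff : Carrier → ℕ → ℕ → Carrier
  coeff d n k = pow d k * ι ((n ℕ.+ k ∸ 1) C k)

  coeff-pascal : ∀ d n k → coeff d (suc n) (suc k) ≈ coeff d n (suc k) + d * coeff d (suc n) k
  coeff-pascal d n k = begin
    dᵏ⁺¹ * ι ((n ℕ.+ suc k) C suc k)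
      ≡⟨ ≡.cong (λ j → dᵏ⁺¹ * ι (j C suc k)) (+-suc n k) ⟩
    dᵏ⁺¹ * ι (suc m C suc k)
      ≡⟨ ≡.cong (λ j → dᵏ⁺¹ * ι j) (≡.sym (nCk+nC[k+1]≡[n+1]C[k+1] m k)) ⟩
    dᵏ⁺¹ * ι (m C k ℕ.+ m C suc k)
      ≈⟨ trans (*-congˡ (ι-+ (m C k) (m C suc k))) (distribˡ dᵏ⁺¹ _ _) ⟩
    dᵏ⁺¹ * ι (m C k) + dᵏ⁺¹ * ι (m C suc k)
      ≈⟨ +-comm _ _ ⟩
    dᵏ⁺¹ * ι (m C suc k) + dᵏ⁺¹ * ι (m C k)
      ≈⟨ +-congˡ (trans (*-congʳ (*-comm (pow d k) d)) (*-assoc d (pow d k) _)) ⟩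
    dᵏ⁺¹ * ι (m C suc k) + d * (pow d k * ι (m C k))
      ≡⟨ ≡.cong (λ j → dᵏ⁺¹ * ι ((j ∸ 1) C suc k) + d * coeff d (suc n) k)
                (≡.sym (+-suc n k)) ⟩
    coeff d n (suc k) + d * coeff d (suc n) k ∎
    where
    m : ℕ
    m = n ℕ.+ k
    dᵏ⁺¹ : Carrier
    dᵏ⁺¹ = pow d (suc k)

  sumTo-coeff₀ : ∀ d K (g : ℕ → Carrier) →
    sumTo (suc K) (λ k → coeff d 0 k * g k) ≈ g 0
  sumTo-coeff₀ d K g = begin
    sumTo (suc K) (λ k → coeff d 0 k * g k)
      ≈⟨ sumTo-head K _ ⟩
    coeff d 0 0 * g 0 + sumTo K (λ k → coeff d 0 (suc k) * g (suc k))
      ≈⟨ +-cong (*-congʳ (trans (*-identityˡ _) (+-identityʳ 1#)))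
                (sumTo-zero K tail≈0) ⟩
    1# * g 0 + 0#
      ≈⟨ trans (+-identityʳ _) (*-identityˡ (g 0)) ⟩
    g 0 ∎
    where
    tail≈0 : ∀ k → coeff d 0 (suc k) * g (suc k) ≈ 0#
    tail≈0 k = begin
      pow d (suc k) * ι (k C suc k) * g (suc k)
        ≡⟨ ≡.cong (λ j → pow d (suc k) * ι j * g (suc k)) (k>n⇒nCk≡0 (n<1+n k)) ⟩
      pow d (suc k) * 0# * g (suc k)
        ≈⟨ trans (*-congʳ (zeroʳ _)) (zeroˡ _) ⟩
      0# ∎

  sumTo-coeff-shift : ∀ d n (g : ℕ → Carrier) K →
    sumTo (suc K) (λ k → coeff d (suc n) k * g (n ℕ.+ k))
      ≈ sumTo (suc K) (λ k → coeff d n k * g (n ℕ.+ k))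
        + d * sumTo K (λ k → coeff d (suc n) k * g (suc n ℕ.+ k))
  sumTo-coeff-shift d n g K = begin
    sumTo (suc K) (λ k → coeff d (suc n) k * g (n ℕ.+ k))
      ≈⟨ sumTo-head K _ ⟩
    head + sumTo K (λ k → coeff d (suc n) (suc k) * g (n ℕ.+ suc k))
      ≈⟨ +-congˡ (sumTo-cong K pascal) ⟩
    head + sumTo K (λ k → coeff d n (suc k) * g (n ℕ.+ suc k) + d * shifted k)
      ≈⟨ +-congˡ (trans (sumTo-+ K _ _) (+-congˡ (sumTo-*ˡ K d shifted))) ⟩
    head + (sumTo K (λ k → coeff d n (suc k) * g (n ℕ.+ suc k)) + d * sumTo K shifted)
      ≈⟨ sym (+-assoc _ _ _) ⟩
    (head + sumTo K (λ k → coeff d n (suc k) * g (n ℕ.+ suc k))) + d * sumTo K shifted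
      ≈⟨ +-congʳ (sym (sumTo-head K _)) ⟩
    sumTo (suc K) (λ k → coeff d n k * g (n ℕ.+ k)) + d * sumTo K shifted ∎
    where
    head : Carrier
    head = coeff d n 0 * g (n ℕ.+ 0)
    shifted : ℕ → Carrier
    shifted k = coeff d (suc n) k * g (suc n ℕ.+ k)
    pascal : ∀ k → coeff d (suc n) (suc k) * g (n ℕ.+ suc k)
                     ≈ coeff d n (suc k) * g (n ℕ.+ suc k) + d * shifted k
    pascal k = begin
      coeff d (suc n) (suc k) * g (n ℕ.+ suc k)
        ≈⟨ trans (*-congʳ (coeff-pascal d n k)) (distribʳ _ _ _) ⟩
      coeff d n (suc k) * g (n ℕ.+ suc k) + d * coeff d (suc n) k * g (n ℕ.+ suc k)
        ≡⟨ ≡.cong (λ j → coeff d n (suc k) * g (n ℕ.+ suc k) + d * coeff d (suc n) k * g j)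
                  (+-suc n k) ⟩
      coeff d n (suc k) * g (n ℕ.+ suc k) + d * coeff d (suc n) k * g (suc n ℕ.+ k)
        ≈⟨ +-congˡ (*-assoc d _ _) ⟩
      coeff d n (suc k) * g (n ℕ.+ suc k) + d * shifted k ∎

  regroup : ∀ d x u u′ y → (u + d * u′) * x + u′ * y ≈ u * x + u′ * (d * x + y)
  regroup d x u u′ y = begin
    (u + d * u′) * x + u′ * y      ≈⟨ +-congʳ (distribʳ x u (d * u′)) ⟩
    (u * x + d * u′ * x) + u′ * y  ≈⟨ +-assoc _ _ _ ⟩
    u * x + (d * u′ * x + u′ * y)  ≈⟨ +-congˡ (+-congʳ d·u′·x≈u′·d·x) ⟩
    u * x + (u′ * (d * x) + u′ * y) ≈⟨ +-congˡ (sym (distribˡ u′ (d * x) y)) ⟩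
    u * x + u′ * (d * x + y)       ∎
    where
    d·u′·x≈u′·d·x : d * u′ * x ≈ u′ * (d * x)
    d·u′·x≈u′·d·x = trans (*-assoc d u′ x) (x∙yz≈y∙xz d u′ x)

  column-expansion : ∀ {v w : Carrier → Carrier} d → (∀ x → d * x + w x ≈ v x) →
    ∀ N xs n K → N ℕ.< K →
    column v N xs n ≈ sumTo K (λ k → coeff d n k * column w N xs (n ℕ.+ k))
  column-expansion {w = w} d vw N xs zero (suc K) _ = sym (sumTo-coeff₀ d K (column w N xs))
  column-expansion d vw zero xs (suc n) K _ = sym (sumTo-zero K (λ k → zeroʳ _))
  column-expansion {v} {w} d vw (suc N) xs (suc n) (suc K) (s≤s N<K) = begin
    colᵛ n * x + colᵛ (suc n) * v x
      ≈⟨ +-congˡ (*-congˡ (sym (vw x))) ⟩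
    colᵛ n * x + colᵛ (suc n) * (d * x + w x)
      ≈⟨ sym (regroup d x (colᵛ n) (colᵛ (suc n)) (w x)) ⟩
    (colᵛ n + d * colᵛ (suc n)) * x + colᵛ (suc n) * w x
      ≈⟨ +-cong (*-congʳ shift) (*-congʳ (IH (suc n) (suc K) (m<n⇒m<1+n N<K))) ⟩
    sumTo (suc K) (λ k → c k * colʷ (n ℕ.+ k)) * x
      + sumTo (suc K) (λ k → c k * colʷ (suc n ℕ.+ k)) * w x
      ≈⟨ sym (+-cong (sumTo-*ʳ (suc K) x _) (sumTo-*ʳ (suc K) (w x) _)) ⟩
    sumTo (suc K) (λ k → c k * colʷ (n ℕ.+ k) * x)
      + sumTo (suc K) (λ k → c k * colʷ (suc n ℕ.+ k) * w x)
      ≈⟨ sym (sumTo-+ (suc K) _ _) ⟩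
    sumTo (suc K) (λ k → c k * colʷ (n ℕ.+ k) * x + c k * colʷ (suc n ℕ.+ k) * w x)
      ≈⟨ sumTo-cong (suc K) (λ k → sym (distrib-assoc (c k) _ _)) ⟩
    sumTo (suc K) (λ k → c k * column w (suc N) xs (suc n ℕ.+ k)) ∎
    where
    xs′ : Fin N → Carrier
    xs′ = xs ∘ inject₁
    x : Carrier
    x = xs (fromℕ N)
    colᵛ colʷ : ℕ → Carrier
    colᵛ = column v N xs′
    colʷ = column w N xs′
    c : ℕ → Carrier
    c = coeff d (suc n)
    IH : ∀ n K → N ℕ.< K → colᵛ n ≈ sumTo K (λ k → coeff d n k * colʷ (n ℕ.+ k))
    IH = column-expansion d vw N xs′
    shift : colᵛ n + d * colᵛ (suc n) ≈ sumTo (suc K) (λ k → c k * colʷ (n ℕ.+ k))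
    shift = trans (+-cong (IH n (suc K) (m<n⇒m<1+n N<K)) (*-congˡ (IH (suc n) K N<K)))
                  (sym (sumTo-coeff-shift d n colʷ K))
    distrib-assoc : ∀ a y z → a * (y * x + z * w x) ≈ a * y * x + a * z * w x
    distrib-assoc a y z =
      trans (distribˡ a _ _) (+-cong (sym (*-assoc a y x)) (sym (*-assoc a z (w x))))

  record ColumnWeights (f : Carrier → List ℕ → List ℕ → Carrier) (w : Carrier → Carrier)
         : Set (r ⊔ ℓ) where
    field
      zeros-stay : ∀ x b → f x (zeros b) (zeros b) ≈ 1#
      col-stay : ∀ x m b → f x (col (suc m) ++ zeros b) (col (suc m) ++ zeros b) ≈ w x
      col-grow : ∀ x m b → f x (col (suc m) ++ zeros b) (col m ++ zeros (suc b)) ≈ x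

  branch-column : ∀ {f w} → ColumnWeights f w →
    ∀ N xs m b → branch f N xs (col m ++ zeros b) ≈ column w N xs m
  branch-column cw zero xs zero b rewrite isEmptyPart-zeros b = refl
  branch-column cw zero xs (suc m) b = refl
  branch-column {f} cw (suc N) xs zero b = begin
    sumL (map g (interl (zeros b)))
      ≡⟨ ≡.cong (sumL ∘ map g) (interl-zeros b) ⟩
    branch f N xs′ (zeros b) * f x (zeros b) (zeros b) + 0#
      ≈⟨ +-identityʳ _ ⟩
    branch f N xs′ (zeros b) * f x (zeros b) (zeros b)
      ≈⟨ *-cong (branch-column cw N xs′ zero b) (zeros-stay x b) ⟩
    1# * 1#
      ≈⟨ *-identityˡ 1# ⟩
    1# ∎
    where
    open ColumnWeights cw
    xs′ : Fin N → Carrier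
    xs′ = xs ∘ inject₁
    x : Carrier
    x = xs (fromℕ N)
    g : List ℕ → Carrier
    g ν = branch f N xs′ ν * f x (zeros b) ν
  branch-column {f} {w} cw (suc N) xs (suc m) b = begin
    sumL (map g (interl (col (suc m) ++ zeros b)))
      ≡⟨ ≡.cong (sumL ∘ map g) (interl-col++zeros m b) ⟩
    g (col m ++ zeros (suc b)) + (g (col (suc m) ++ zeros b) + 0#)
      ≈⟨ +-cong (*-cong (branch-column cw N xs′ m (suc b)) (col-grow x m b))
                (trans (+-identityʳ _)
                       (*-cong (branch-column cw N xs′ (suc m) b) (col-stay x m b))) ⟩
    column w N xs′ m * x + column w N xs′ (suc m) * w x ∎
    where
    open ColumnWeights cw
    xs′ : Fin N → Carrier
    xs′ = xs ∘ inject₁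
    x : Carrier
    x = xs (fromℕ N)
    g : List ℕ → Carrier
    g ν = branch f N xs′ ν * f x (col (suc m) ++ zeros b) ν

  branch-col : ∀ {f w} → ColumnWeights f w →
    ∀ N xs m → branch f N xs (col m) ≈ column w N xs m
  branch-col cw N xs m = begin
    branch _ N xs (col m)
      ≡⟨ ≡.cong (branch _ N xs) (≡.sym (++-identityʳ (col m))) ⟩
    branch _ N xs (col m ++ zeros 0)
      ≈⟨ branch-column cw N xs m 0 ⟩
    column _ N xs m ∎

  qbinom-1-1 : ∀ q → qbinom q 1 1 ≈ 1#
  qbinom-1-1 q = trans (+-congˡ (zeroʳ _)) (+-identityʳ 1#)

  poch-1 : ∀ x q → poch x q 1 ≈ 1# - x
  poch-1 x q = trans (*-identityˡ _) (+-congˡ (-‿cong (*-identityʳ x)))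

  pow-sum-stay : ∀ x L → pow x (sum L ∸ sum L) ≈ 1#
  pow-sum-stay x L = reflexive (≡.cong (pow x) (n∸n≡0 (sum L)))

  pow-sum-grow : ∀ x m b →
    pow x (sum (col (suc m) ++ zeros b) ∸ sum (col m ++ zeros (suc b))) ≈ x
  pow-sum-grow x m b = begin
    pow x (sum (col (suc m) ++ zeros b) ∸ sum (col m ++ zeros (suc b)))
      ≡⟨ ≡.cong (λ j → pow x (suc j ∸ sum (col m ++ zeros (suc b)))) (sum-col++zeros m b) ⟩
    pow x (suc m ∸ sum (col m ++ zeros (suc b)))
      ≡⟨ ≡.cong (λ j → pow x (suc m ∸ j)) (sum-col++zeros m (suc b)) ⟩
    pow x (suc m ∸ m)
      ≡⟨ ≡.cong (pow x) (m+n∸n≡m 1 m) ⟩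
    1# * x
      ≈⟨ *-identityˡ x ⟩
    x ∎

  wprod-stay : ∀ q L → wprod q L L ≈ 1#
  wprod-stay q [] = refl
  wprod-stay q (a ∷ []) = reflexive (≡.cong (qbinom q a) (n∸n≡0 a))
  wprod-stay q (a ∷ b ∷ l) =
    trans (*-cong (reflexive (≡.cong (qbinom q (a ∸ b)) (n∸n≡0 a)))
                  (wprod-stay q (b ∷ l)))
          (*-identityˡ 1#)

  wprod-lastRow : ∀ q a m b → wprod q (a ∷ zeros b) (m ∷ zeros b) ≈ qbinom q a (a ∸ m)
  wprod-lastRow q a m zero = refl
  wprod-lastRow q a m (suc b) = trans (*-congˡ (wprod-stay q (zeros (suc b)))) (*-identityʳ _)

  wprod-grow : ∀ q m b → wprod q (col (suc m) ++ zeros b) (col m ++ zeros (suc b)) ≈ 1#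
  wprod-grow q zero b = trans (wprod-lastRow q 1 0 b) (qbinom-1-1 q)
  wprod-grow q (suc m) b = trans (*-identityˡ _) (wprod-grow q m b)

  fprod-zeros : ∀ q x b → fprod q x (zeros b) (zeros b) ≈ 1#
  fprod-zeros q x zero = refl
  fprod-zeros q x (suc zero) = *-identityˡ 1#
  fprod-zeros q x (suc (suc b)) =
    trans (*-cong (*-identityˡ 1#) (fprod-zeros q x (suc b))) (*-identityˡ 1#)

  fprod-lastRow : ∀ q x a m b →
    fprod q x (a ∷ zeros b) (m ∷ zeros b) ≈ poch x q m * qbinom q a (a ∸ m)
  fprod-lastRow q x a m zero = refl
  fprod-lastRow q x a m (suc b) = trans (*-congˡ (fprod-zeros q x (suc b))) (*-identityʳ _)

  fprod-fullRow : ∀ q x l μ → fprod q x (1 ∷ 1 ∷ l) (1 ∷ μ) ≈ fprod q x (1 ∷ l) μ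
  fprod-fullRow q x l μ = trans (*-congʳ (*-identityˡ 1#)) (*-identityˡ _)

  fprod-stay : ∀ q x m b →
    fprod q x (col (suc m) ++ zeros b) (col (suc m) ++ zeros b) ≈ 1# - x
  fprod-stay q x zero b = trans (fprod-lastRow q x 1 1 b) (trans (*-identityʳ _) (poch-1 x q))
  fprod-stay q x (suc m) b =
    trans (fprod-fullRow q x (col m ++ zeros b) (col (suc m) ++ zeros b)) (fprod-stay q x m b)

  fprod-grow : ∀ q x m b → fprod q x (col (suc m) ++ zeros b) (col m ++ zeros (suc b)) ≈ 1#
  fprod-grow q x zero b = trans (fprod-lastRow q x 1 0 b) (trans (*-identityˡ _) (qbinom-1-1 q))
  fprod-grow q x (suc m) b =
    trans (fprod-fullRow q x (col m ++ zeros b) (col m ++ zeros (suc b))) (fprod-grow q x m b)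

  Wskew-columnWeights : ∀ q → ColumnWeights (Wskew q) (λ _ → 1#)
  Wskew-columnWeights q = record
    { zeros-stay = λ x b → stay x (zeros b)
    ; col-stay = λ x m b → stay x (col (suc m) ++ zeros b)
    ; col-grow = λ x m b →
        trans (*-cong (pow-sum-grow x m b) (wprod-grow q m b)) (*-identityʳ x)
    }
    where
    stay : ∀ x L → Wskew q x L L ≈ 1#
    stay x L = trans (*-cong (pow-sum-stay x L) (wprod-stay q L)) (*-identityˡ 1#)

  Fskew-columnWeights : ∀ q → ColumnWeights (Fskew q) (λ x → 1# - x)
  Fskew-columnWeights q = record
    { zeros-stay = λ x b →
        trans (*-cong (pow-sum-stay x (zeros b)) (fprod-zeros q x b)) (*-identityˡ 1#)
    ; col-stay = λ x m b →
        trans (*-cong (pow-sum-stay x (col (suc m) ++ zeros b)) (fprod-stay q x m b))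
              (*-identityˡ _)
    ; col-grow = λ x m b →
        trans (*-cong (pow-sum-grow x m b) (fprod-grow q x m b)) (*-identityʳ x)
    }

proposition4p13 : ∀ {c ℓ} (R : CommutativeRing c ℓ) → let open Sym R in
    (q : Carrier) (n : ℕ) → 1 ≤ n → (N : ℕ) (xs : Fin N → Carrier) →
      (Σ[ K₀ ∈ ℕ ] ∀ K → K₀ ≤ K →
         W q N xs (col n) ≈ sumTo K (λ k → ι ((n ℕ.+ k ∸ 1) C k) * 𝔽 q N xs (col (n ℕ.+ k))))
    × (Σ[ K₀ ∈ ℕ ] ∀ K → K₀ ≤ K →
         𝔽 q N xs (col n) ≈ sumTo K (λ k → pow (- 1#) k * ι ((n ℕ.+ k ∸ 1) C k) * W q N xs (col (n ℕ.+ k))))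
proposition4p13 R q n _ N xs =
    (suc N , λ K N<K → begin
      W q N xs (col n)
        ≈⟨ W-col n ⟩
      column (λ _ → 1#) N xs n
        ≈⟨ column-expansion 1# 1x+[1-x]≈1 N xs n K N<K ⟩
      sumTo K (λ k → coeff 1# n k * column (λ x → 1# - x) N xs (n ℕ.+ k))
        ≈⟨ sumTo-cong K (λ k → *-cong (coeff-1# k) (sym (𝔽-col (n ℕ.+ k)))) ⟩
      sumTo K (λ k → ι ((n ℕ.+ k ∸ 1) C k) * 𝔽 q N xs (col (n ℕ.+ k))) ∎)
  , (suc N , λ K N<K → begin
      𝔽 q N xs (col n)
        ≈⟨ 𝔽-col n ⟩
      column (λ x → 1# - x) N xs n
        ≈⟨ column-expansion (- 1#) -1x+1≈1-x N xs n K N<K ⟩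
      sumTo K (λ k → coeff (- 1#) n k * column (λ _ → 1#) N xs (n ℕ.+ k))
        ≈⟨ sumTo-cong K (λ k → *-congˡ (sym (W-col (n ℕ.+ k)))) ⟩
      sumTo K (λ k → pow (- 1#) k * ι ((n ℕ.+ k ∸ 1) C k) * W q N xs (col (n ℕ.+ k))) ∎)
  where
  open Sym R hiding (zero)
  open ColumnFunctions R
  open SetoidReasoning setoid
  W-col : ∀ m → W q N xs (col m) ≈ column (λ _ → 1#) N xs m
  W-col = branch-col (Wskew-columnWeights q) N xs
  𝔽-col : ∀ m → 𝔽 q N xs (col m) ≈ column (λ x → 1# - x) N xs m
  𝔽-col = branch-col (Fskew-columnWeights q) N xs
  coeff-1# : ∀ k → coeff 1# n k ≈ ι ((n ℕ.+ k ∸ 1) C k)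
  coeff-1# k = trans (*-congʳ (pow-1# k)) (*-identityˡ _)
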